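{- Let $f\colon\mathbb{N}^2\to\mathbb{N}$ be any max-dominating pairing function. Define $\phi_f$ on $\mathbb{N}$ by $\phi_f(0)=o$ and, for each pair $(x,y)\in\mathbb{N}^2$, $\phi_f(f(x,y)+1)=\tau(\phi_f(x),\phi_f(y))$. Then $\phi_f$ is an enumeration of the set $T$ of full binary trees, i.e. a bijection from $\mathbb{N}$ onto $T$.
   Context: $\mathbb{N}$ denotes the set of non-negative integers. A pairing function for $\mathbb{N}$ is a bijection $\mathbb{N}^2\to\mathbb{N}$; it is max-dominating if $\max(x,y)\le f(x,y)$ for all $(x,y)\in\mathbb{N}^2$. $o$ denotes the binary tree with a single vertex, and $\tau(a,b)$ denotes the binary tree whose root has left subtree $a$ and right subtree $b$. The set $T$ of full binary trees is the smallest set containing $o$ and closed under $\tau$. (Since $f$ is a bijection and $x,y\le f(x,y)<f(x,y)+1$, the recursion defining $\phi_f$ determines a unique function on $\mathbb{N}$.) -}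

module Defs where

open import Data.Nat using (ℕ; zero; suc; _≤_; _⊔_)
open import Data.Product using (_×_; _,_; Σ)
open import Function.Definitions using (Bijective)
open import Relation.Binary.PropositionalEquality using (_≡_)

data Tree : Set where
  o : Tree
  τ : Tree → Tree → Tree

IsPairing : (ℕ × ℕ → ℕ) → Set
IsPairing f = Bijective _≡_ _≡_ f

MaxDominating : (ℕ × ℕ → ℕ) → Set
MaxDominating f = ∀ x y → x ⊔ y ≤ f (x , y)

IsPhi : (ℕ × ℕ → ℕ) → (ℕ → Tree) → Set
IsPhi f φ = (φ 0 ≡ o) × (∀ x y → φ (suc (f (x , y))) ≡ τ (φ x) (φ y))

module Submission where

-- Encode trees as numbers by  code o = 0  and
-- code (τ a b) = f (code a , code b) + 1.  Since f is injective, code is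
-- injective (structural induction on trees).  Since f is surjective and
-- max-dominating, every n + 1 is f (x , y) + 1 with x , y ≤ n, so code is
-- surjective (strong induction on ℕ).  Hence code is a bijection ℕ ≅ T, and
-- the recursion for φ_f just says that φ_f is its inverse:
--   * any φ with  code ∘ φ = id  satisfies the recursion, by injectivity of
--     code; choosing φ n as a code-preimage of n gives existence;
--   * any φ satisfying the recursion has  φ ∘ code = id  (tree induction),
--     and a left inverse of a surjection is a bijection.

open import Defs
open import Data.Nat using (ℕ; zero; suc; _≤_; _<_; _⊔_; s≤s)
open import Data.Nat.Properties using (m≤m⊔n; m≤n⊔m; ≤-trans; suc-injective)
open import Data.Nat.Induction using (<-rec)
open import Data.Product using (_×_; _,_; Σ; ∃; proj₁; proj₂)
open import Function.Definitions using (Bijective; Surjective; StrictlySurjective)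
open import Function.Consequences.Propositional using (strictlySurjective⇒surjective)
open import Relation.Binary.PropositionalEquality
  using (_≡_; refl; sym; trans; cong; cong₂; module ≡-Reasoning)

-- A left inverse φ of a surjection g (φ ∘ g = id) is a bijection:
-- it is surjective via g, and injective because every input lies in the
-- image of g, where φ is undone by g.
leftInverse-of-surjection-bijective :
  {A B : Set} (g : A → B) (φ : B → A) →
  StrictlySurjective _≡_ g → (∀ a → φ (g a) ≡ a) → Bijective _≡_ _≡_ φ
leftInverse-of-surjection-bijective g φ g-surj φg≡id = injective , surjective
  where
  open ≡-Reasoning

  injective : ∀ {x y} → φ x ≡ φ y → x ≡ y
  injective {x} {y} φx≡φy with g-surj x | g-surj y
  ... | a , refl | b , refl = cong g (begin
    a         ≡⟨ sym (φg≡id a) ⟩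
    φ (g a)   ≡⟨ φx≡φy ⟩
    φ (g b)   ≡⟨ φg≡id b ⟩
    b         ∎)

  surjective : Surjective _≡_ _≡_ φ
  surjective = strictlySurjective⇒surjective (λ a → g a , φg≡id a)

module _ (f : ℕ × ℕ → ℕ) (pairing : IsPairing f) (dominating : MaxDominating f) where

  code : Tree → ℕ
  code o       = 0
  code (τ a b) = suc (f (code a , code b))

  code-injective : ∀ {s t} → code s ≡ code t → s ≡ t
  code-injective {o}     {o}     _ = refl
  code-injective {τ a b} {τ c d} eq =
    cong₂ τ (code-injective (cong proj₁ codes≡)) (code-injective (cong proj₂ codes≡))
    where
    codes≡ : (code a , code b) ≡ (code c , code d)
    codes≡ = proj₁ pairing (suc-injective eq)
  code-injective {o}     {τ _ _} ()
  code-injective {τ _ _} {o}     ()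

  -- Every n is f (x , y) for some x , y ≤ n: f is onto and dominates max.
  unpair : ∀ n → Σ (ℕ × ℕ) λ { (x , y) → x ≤ n × y ≤ n × f (x , y) ≡ n }
  unpair n with proj₂ pairing n
  ... | (x , y) , fxy≡ =
    (x , y) , bound (m≤m⊔n x y) , bound (m≤n⊔m x y) , fxy≡ refl
    where
    bound : ∀ {z} → z ≤ x ⊔ y → z ≤ n
    bound z≤ with fxy≡ refl
    ... | refl = ≤-trans z≤ (dominating x y)

  -- code is surjective, by strong induction: n + 1 = f (x , y) + 1 with
  -- x , y < n + 1 already coded.
  code-surjective : StrictlySurjective _≡_ code
  code-surjective = <-rec (λ n → ∃ λ t → code t ≡ n) step
    where
    step : ∀ n → (∀ {m} → m < n → ∃ λ t → code t ≡ m) → ∃ λ t → code t ≡ n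
    step zero    _   = o , refl
    step (suc n) rec with unpair n
    ... | (x , y) , x≤n , y≤n , refl with rec (s≤s x≤n) | rec (s≤s y≤n)
    ...   | a , refl | b , refl = τ a b , refl

  rightInverse-isPhi : (φ : ℕ → Tree) → (∀ n → code (φ n) ≡ n) → IsPhi f φ
  rightInverse-isPhi φ codeφ≡id = code-injective (codeφ≡id 0) , recursion
    where
    open ≡-Reasoning
    recursion : ∀ x y → φ (suc (f (x , y))) ≡ τ (φ x) (φ y)
    recursion x y = code-injective (begin
      code (φ (suc (f (x , y))))       ≡⟨ codeφ≡id _ ⟩
      suc (f (x , y))                  ≡⟨ cong₂ (λ u v → suc (f (u , v)))
                                                  (sym (codeφ≡id x)) (sym (codeφ≡id y)) ⟩
      code (τ (φ x) (φ y))             ∎)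

  decode : ℕ → Tree
  decode n = proj₁ (code-surjective n)

  code-decode : ∀ n → code (decode n) ≡ n
  code-decode n = proj₂ (code-surjective n)

  isPhi-leftInverse : (φ : ℕ → Tree) → IsPhi f φ → ∀ t → φ (code t) ≡ t
  isPhi-leftInverse φ (φ0≡o , _) o         = φ0≡o
  isPhi-leftInverse φ isPhi@(_ , φτ) (τ a b) =
    trans (φτ (code a) (code b))
          (cong₂ τ (isPhi-leftInverse φ isPhi a) (isPhi-leftInverse φ isPhi b))

  isPhi-bijective : (φ : ℕ → Tree) → IsPhi f φ → Bijective _≡_ _≡_ φ
  isPhi-bijective φ isPhi =
    leftInverse-of-surjection-bijective code φ code-surjective (isPhi-leftInverse φ isPhi)

theorem8 : (f : ℕ × ℕ → ℕ) → IsPairing f → MaxDominating f →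
    Σ (ℕ → Tree) (λ φ → IsPhi f φ × Bijective _≡_ _≡_ φ)
      × ((φ : ℕ → Tree) → IsPhi f φ → Bijective _≡_ _≡_ φ)
theorem8 f pairing dominating =
  (decode f pairing dominating , decodeIsPhi , isPhi-bijective f pairing dominating _ decodeIsPhi)
  , isPhi-bijective f pairing dominating
  where
  decodeIsPhi : IsPhi f (decode f pairing dominating)
  decodeIsPhi = rightInverse-isPhi f pairing dominating _ (code-decode f pairing dominating)
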